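{- Let $\ell\ge 4$ be an integer, $f$ a slow function and $G$ the $(f,\ell)$-layered wheel. Then every hole of $G$ has length at least $\ell$.
   Context: A hole is a chordless cycle of length at least 4. A function $f:\mathbb N\setminus\{0\}\to\mathbb N\setminus\{0\}$ is slow if $f(1)=1,f(2)=2,f(3)=3$ and $f(i)\le f(i+1)\le f(i)+1$ for all $i$. The $(f,\ell)$-layered wheel $G$ is the infinite graph (considered as an undirected simple graph; orientations only descriptive) whose vertex set is partitioned into finite layers $L_1,L_2,\dots$, built inductively. For $v\in L_i$ let $N^\uparrow(v)$ be the set of neighbours of $v$ in $L_1\cup\dots\cup L_{i-1}$ and $N^\uparrow[v]=N^\uparrow(v)\cup\{v\}$. $L_1$ induces a directed cycle of length $\ell$. Given $L_1,\dots,L_i$, for each $v\in L_i$ create a directed path $L(v)=v_1\dots v_{n_v}$ of new vertices: (a) if $|N^\uparrow(v)|<f(i+1)-1$, then $n_v=\ell-2$, $N^\uparrow(v_1)=N^\uparrow[v]$ and $N^\uparrow(v_j)=\emptyset$ for $j\ge2$; (b) if $|N^\uparrow(v)|=f(i+1)-1=:m$, write $N^\uparrow(v)=\{w_1,\dots,w_m\}$; then $n_v=m(\ell-2)$, $N^\uparrow(v_{(j-1)(\ell-2)+1})=N^\uparrow[v]\setminus\{w_j\}$ for $j=1,\dots,m$, and all other vertices of $L(v)$ have $N^\uparrow=\emptyset$ (the construction guarantees $|N^\uparrow(v)|\le f(i+1)-1$ always). Specifying $N^\uparrow(u)$ for a new vertex $u$ means $u$ is adjacent exactly to those vertices of earlier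 layers. $L_{i+1}=\bigcup_{v\in L_i}V(L(v))$ induces the directed cycle obtained from the paths $L(v)$ by adding, for every arc $vv'$ of the cycle $L_i$, the arc $v_{n_v}v'_1$. -}

module Defs where

open import Data.Nat using (ℕ; zero; suc; _+_; _∸_; _≤_; _<_; _<ᵇ_)
open import Data.Bool using (if_then_else_)
open import Data.Product using (_×_; _,_; proj₁; proj₂)
open import Data.Sum using (_⊎_)
open import Data.List using (List; []; _∷_; length; replicate; _++_; concat)
open import Data.List.Membership.Propositional using (_∈_)
open import Data.List.Relation.Binary.Permutation.Propositional using (_↭_)
open import Data.Fin using (Fin; toℕ)
open import Function.Definitions using (Injective)
open import Relation.Binary.PropositionalEquality using (_≡_)

-- A function f : ℕ∖{0} → ℕ∖{0}, represented as ℕ → ℕ (value at 0 irrelevant).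
record Slow (f : ℕ → ℕ) : Set where
  field
    f1 : f 1 ≡ 1
    f2 : f 2 ≡ 2
    f3 : f 3 ≡ 3
    step : ∀ i → 1 ≤ i → f i ≤ f (suc i) × f (suc i) ≤ suc (f i)

-- A vertex is (layer index i ≥ 1 as in the paper, position in layer L_i).
Vtx : Set
Vtx = ℕ × ℕ

nth : {A : Set} → A → List A → ℕ → A
nth d []       _       = d
nth d (x ∷ xs) zero    = x
nth d (x ∷ xs) (suc n) = nth d xs n

removeAt : {A : Set} → List A → ℕ → List A
removeAt []       _       = []
removeAt (x ∷ xs) zero    = xs
removeAt (x ∷ xs) (suc n) = x ∷ removeAt xs n

-- Choice of the enumeration w_1,…,w_m of N↑(v) for v = (i , p): σ i p U.
Ordering : Set
Ordering = ℕ → ℕ → List Vtx → List Vtx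

ValidOrdering : Ordering → Set
ValidOrdering σ = ∀ i p U → σ i p U ↭ U

module Wheel (ℓ : ℕ) (f : ℕ → ℕ) (σ : Ordering) where

  -- A layer is the cyclically ordered list of the upward neighbourhoods N↑ of
  -- its vertices (position in the list = position along the directed cycle).
  Layer : Set
  Layer = List (List Vtx)

  blank : Layer
  blank = replicate (ℓ ∸ 3) []

  -- case (b): blocks of length ℓ-2, the j-th block starting with N↑[v] ∖ {w_j}
  blocks : Vtx → List Vtx → ℕ → Layer
  blocks v ws zero    = []
  blocks v ws (suc j) = blocks v ws j ++ ((v ∷ removeAt ws j) ∷ blank)

  -- the path L(v) for v = (i , p) with N↑(v) = U
  path : ℕ → ℕ → List Vtx → Layer
  path i p U =
    if length U <ᵇ (f (suc i) ∸ 1)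
    then ((i , p) ∷ U) ∷ blank
    else blocks (i , p) (σ i p U) (length U)

  expand : ℕ → ℕ → Layer → Layer
  expand i p []       = []
  expand i p (U ∷ Us) = path i p U ++ expand i (suc p) Us

  -- layer i (paper indexing, i ≥ 1; layer 0 is empty and unused)
  layer : ℕ → Layer
  layer zero          = []
  layer (suc zero)    = replicate ℓ []
  layer (suc (suc i)) = expand (suc i) 0 (layer (suc i))

  size : ℕ → ℕ
  size i = length (layer i)

  up : Vtx → List Vtx
  up (i , p) = nth [] (layer i) p

  Valid : Vtx → Set
  Valid (i , p) = 1 ≤ i × p < size i

  CycNext : ℕ → ℕ → ℕ → Set
  CycNext n p q = (suc p ≡ q) ⊎ (suc p ≡ n × q ≡ 0)

  Adj : Vtx → Vtx → Set
  Adj (i , p) (j , q) =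
      (i ≡ j × (CycNext (size i) p q ⊎ CycNext (size i) q p))
    ⊎ (j < i × (j , q) ∈ up (i , p))
    ⊎ (i < j × (i , p) ∈ up (j , q))

  CycAdjFin : (k : ℕ) → Fin k → Fin k → Set
  CycAdjFin k a b = CycNext k (toℕ a) (toℕ b) ⊎ CycNext k (toℕ b) (toℕ a)

  IsHole : (k : ℕ) → (Fin k → Vtx) → Set
  IsHole k c =
      4 ≤ k
    × (∀ a → Valid (c a))
    × Injective _≡_ _≡_ c
    × (∀ a b → (Adj (c a) (c b) → CycAdjFin k a b) × (CycAdjFin k a b → Adj (c a) (c b)))

-- Let i be the highest layer met by a hole C. Upward neighbourhoods are cliques, because
-- N↑(u) ⊆ N↑[v] for u ∈ L(v); hence no vertex of C in L_i has both of its C-neighbours in lower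
-- layers, and the vertices of C in L_i either are all of C or form runs of at least two vertices
-- whose two ends have a C-neighbour below. As C never turns back, such a run moves in one
-- direction around the cycle L_i. If C ⊆ L_i, then C winds around L_i, so |C| ≥ |L_i| ≥ ℓ.
-- Otherwise i ≥ 2, and L_i is cut into blocks of length ℓ - 2 in which only the first vertex has
-- upward neighbours; both ends of a run are such first vertices, so the run spans a positive
-- multiple of ℓ - 2 steps, i.e. at least ℓ - 1 vertices, and C has a further vertex below L_i.

module Submission where

open import Defs
open import Algebra.Properties.CommutativeSemigroup using (x∙yz≈y∙xz)
open import Data.Bool using (true; false; if_then_else_)
open import Data.Empty using (⊥-elim)
open import Data.Fin using (Fin; toℕ; fromℕ<; zero)
open import Data.Fin.Properties using (toℕ-fromℕ<; toℕ-injective; toℕ<n; all?; ¬∀⟶∃¬)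
open import Data.List using (List; []; _∷_; length; replicate; _++_; allFin)
open import Data.List.Extrema.Nat using (argmax; f[xs]≤f[argmax])
open import Data.List.Membership.Propositional using (_∈_)
open import Data.List.Membership.Propositional.Properties using (∉[]; ∈-++⁻; ∈-allFin)
open import Data.List.Properties using (length-++; length-replicate)
open import Data.List.Relation.Binary.Permutation.Propositional.Properties using (∈-resp-↭)
open import Data.List.Relation.Binary.Subset.Propositional using (_⊆_)
open import Data.List.Relation.Unary.All using (lookup)
open import Data.List.Relation.Unary.All.Properties using (replicate⁺)
open import Data.List.Relation.Unary.Any using (here; there)
open import Data.Nat using (ℕ; zero; suc; _+_; _*_; _∸_; _%_; _/_; _≤_; _<_; _<ᵇ_; z≤n; s≤s; _≟_; NonZero)
open import Data.Nat.DivMod using (m≡m%n+[m/n]*n; [m+kn]%n≡m%n; %-remove-+ˡ; m%n<n; m<n⇒m%n≡m; n%n≡0)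
open import Data.Nat.Divisibility using (_∣_; divides; _∣0; ∣-refl; ∣m∣n⇒∣m+n; ∣m+n∣m⇒∣n; ∣n⇒∣m*n; ∣⇒≤)
open import Data.Nat.Properties
  using ( ≤-refl; ≤-reflexive; ≤-trans; <⇒≤; <-irrefl; <-asym; ≤∧≢⇒<; suc-injective; n≤1+n; n<1+n
        ; m≤n⇒m≤1+n; m<n⇒m<1+n; m≤n⇒m<n∨m≡n; m<1+n⇒m<n∨m≡n; m≤m+n; m≤n+m; m≤n+m∸n; m∸n+n≡m
        ; ∸-monoˡ-≤; +-mono-≤; +-suc; +-identityʳ; +-cancelˡ-≡; +-commutativeSemigroup )
open import Data.Product using (∃-syntax; _×_; _,_; proj₁; proj₂)
open import Data.Product.Properties using (×-≡,≡→≡)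
open import Data.Sum using (_⊎_; inj₁; inj₂)
open import Function using (_∘_)
open import Function.Definitions using (Injective)
open import Relation.Nullary using (¬_; yes; no)
open import Relation.Unary using (Decidable)
open import Relation.Binary.PropositionalEquality
  using (_≡_; _≢_; refl; sym; trans; cong; subst; subst₂; module ≡-Reasoning)

open ≡-Reasoning

-- CycNext does not depend on the parameters of the wheel.
open Wheel 0 (λ _ → 0) (λ _ _ U → U) using (CycNext)

CycAdj : ℕ → ℕ → ℕ → Set
CycAdj n p q = CycNext n p q ⊎ CycNext n q p

cycNext-injectiveˡ : ∀ {n p q r} → CycNext n p r → CycNext n q r → p ≡ q
cycNext-injectiveˡ (inj₁ refl)       (inj₁ e)          = sym (suc-injective e)
cycNext-injectiveˡ (inj₁ refl)       (inj₂ (_ , ()))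
cycNext-injectiveˡ (inj₂ (_ , refl)) (inj₁ ())
cycNext-injectiveˡ (inj₂ (e , refl)) (inj₂ (e′ , _)) = suc-injective (trans e (sym e′))

cycNext-functional : ∀ {n p q r} → q < n → r < n → CycNext n p q → CycNext n p r → q ≡ r
cycNext-functional _   _   (inj₁ refl)       (inj₁ refl)       = refl
cycNext-functional q<n _   (inj₁ refl)       (inj₂ (e , refl)) = ⊥-elim (<-irrefl e q<n)
cycNext-functional _   r<n (inj₂ (e , refl)) (inj₁ refl)       = ⊥-elim (<-irrefl e r<n)
cycNext-functional _   _   (inj₂ (_ , refl)) (inj₂ (_ , refl)) = refl

cycNext²-≢ : ∀ {n p q r} → CycNext n p q → CycNext n q r → 3 ≤ n → r ≢ p
cycNext²-≢ (inj₁ refl)          (inj₁ refl)          _                ()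
cycNext²-≢ (inj₁ refl)          (inj₂ (refl , refl)) (s≤s (s≤s ()))   refl
cycNext²-≢ (inj₂ (refl , refl)) (inj₁ refl)          (s≤s (s≤s ()))   refl
cycNext²-≢ (inj₂ (refl , refl)) (inj₂ (refl , refl)) (s≤s ())         _

cycNext²-¬cycAdj : ∀ {n p q r} → CycNext n p q → CycNext n q r → 4 ≤ n → ¬ CycAdj n p r
cycNext²-¬cycAdj (inj₁ refl) (inj₁ refl) _ (inj₁ (inj₁ ()))
cycNext²-¬cycAdj (inj₁ refl) (inj₁ refl) _ (inj₁ (inj₂ (_ , ())))
cycNext²-¬cycAdj (inj₁ refl) (inj₁ refl) _ (inj₂ (inj₁ ()))
cycNext²-¬cycAdj (inj₁ refl) (inj₁ refl) (s≤s (s≤s (s≤s ()))) (inj₂ (inj₂ (refl , refl)))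
cycNext²-¬cycAdj (inj₁ refl) (inj₂ (refl , refl)) _ (inj₁ (inj₁ ()))
cycNext²-¬cycAdj (inj₁ refl) (inj₂ (refl , refl)) _ (inj₁ (inj₂ (() , _)))
cycNext²-¬cycAdj (inj₁ refl) (inj₂ (refl , refl)) (s≤s (s≤s (s≤s ()))) (inj₂ (inj₁ refl))
cycNext²-¬cycAdj (inj₂ (refl , refl)) (inj₁ refl) (s≤s ()) (inj₁ (inj₁ refl))
cycNext²-¬cycAdj (inj₂ (refl , refl)) (inj₁ refl) _ (inj₁ (inj₂ (_ , ())))
cycNext²-¬cycAdj (inj₂ (refl , refl)) (inj₁ refl) (s≤s (s≤s (s≤s ()))) (inj₂ (inj₁ refl))
cycNext²-¬cycAdj (inj₂ (refl , refl)) (inj₂ (refl , refl)) (s≤s ()) _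

cycNext-% : ∀ n .{{_ : NonZero n}} t → CycNext n (t % n) (suc t % n)
cycNext-% n t = subst (CycNext n (t % n)) (sym suc-%) (cycNext-< (m%n<n t n))
  where
    cycNext-< : ∀ {p} → p < n → CycNext n p (suc p % n)
    cycNext-< p<n with m≤n⇒m<n∨m≡n p<n
    ... | inj₁ 1+p<n = inj₁ (sym (m<n⇒m%n≡m 1+p<n))
    ... | inj₂ refl  = inj₂ (refl , n%n≡0 n)
    suc-% : suc t % n ≡ suc (t % n) % n
    suc-% = begin
      suc t % n                        ≡⟨ cong (λ x → suc x % n) (m≡m%n+[m/n]*n t n) ⟩
      (suc (t % n) + (t / n) * n) % n ≡⟨ [m+kn]%n≡m%n (suc (t % n)) (t / n) n ⟩
      suc (t % n) % n                  ∎

-- r steps in one direction around an n-cycle lead from x to y, making q full turns.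
WindsTo : ℕ → ℕ → ℕ → ℕ → Set
WindsTo n x r y = ∃[ q ] (y + q * n ≡ x + r ⊎ x + q * n ≡ y + r)

windsTo-∣ : ∀ {d n x r y} → d ∣ n → d ∣ x → d ∣ y → WindsTo n x r y → d ∣ r
windsTo-∣ {d} d∣n d∣x d∣y (q , inj₁ e) =
  ∣m+n∣m⇒∣n (subst (d ∣_) e (∣m∣n⇒∣m+n d∣y (∣n⇒∣m*n q d∣n))) d∣x
windsTo-∣ {d} d∣n d∣x d∣y (q , inj₂ e) =
  ∣m+n∣m⇒∣n (subst (d ∣_) e (∣m∣n⇒∣m+n d∣x (∣n⇒∣m*n q d∣n))) d∣y

windsTo-closed : ∀ {n x r} → WindsTo n x r x → n ∣ r
windsTo-closed {x = x} (q , inj₁ e) = divides q (sym (+-cancelˡ-≡ x _ _ e))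
windsTo-closed {x = x} (q , inj₂ e) = divides q (sym (+-cancelˡ-≡ x _ _ e))

extend-< : ∀ {Q : ℕ → Set} {r} → (∀ j → j < r → Q j) → Q r → ∀ j → j < suc r → Q j
extend-< h q j j<1+r with m<1+n⇒m<n∨m≡n j<1+r
... | inj₁ j<r  = h j j<r
... | inj₂ refl = q

module CycleWalk (n : ℕ) (P : ℕ → ℕ) where

  Forward Backward : ℕ → Set
  Forward  r = ∀ j → j < r → CycNext n (P j) (P (suc j))
  Backward r = ∀ j → j < r → CycNext n (P (suc j)) (P j)

  monotone : ∀ r → (∀ j → j ≤ r → P j < n) → (∀ j → j < r → CycAdj n (P j) (P (suc j)))
           → (∀ j → suc j < r → P (suc (suc j)) ≢ P j) → Forward r ⊎ Backward r
  monotone zero          _     _    _     = inj₁ (λ _ ())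
  monotone (suc zero)    _     step _     with step 0 (s≤s z≤n)
  ... | inj₁ s = inj₁ (extend-< (λ _ ()) s)
  ... | inj₂ s = inj₂ (extend-< (λ _ ()) s)
  monotone (suc (suc r)) valid step fresh
    with monotone (suc r) (λ j h → valid j (m≤n⇒m≤1+n h)) (λ j h → step j (m<n⇒m<1+n h))
                          (λ j h → fresh j (m<n⇒m<1+n h))
       | step (suc r) ≤-refl
  ... | inj₁ fw | inj₁ s = inj₁ (extend-< fw s)
  ... | inj₂ bw | inj₂ s = inj₂ (extend-< bw s)
  ... | inj₁ fw | inj₂ s = ⊥-elim (fresh r ≤-refl (sym (cycNext-injectiveˡ (fw r (n<1+n r)) s)))
  ... | inj₂ bw | inj₁ s = ⊥-elim (fresh r ≤-refl (sym
        (cycNext-functional (valid r (m≤n⇒m≤1+n (n≤1+n r))) (valid (suc (suc r)) ≤-refl)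
                            (bw r (n<1+n r)) s)))

  forward-winds : ∀ r → Forward r → ∃[ q ] P r + q * n ≡ P 0 + r
  forward-winds zero    _  = 0 , refl
  forward-winds (suc r) fw with forward-winds r (λ j h → fw j (m<n⇒m<1+n h)) | fw r ≤-refl
  ... | q , e | inj₁ next = q , (begin
    P (suc r) + q * n   ≡⟨ cong (_+ q * n) (sym next) ⟩
    suc (P r + q * n)   ≡⟨ cong suc e ⟩
    suc (P 0 + r)       ≡⟨ sym (+-suc (P 0) r) ⟩
    P 0 + suc r         ∎)
  ... | q , e | inj₂ (wrap , at0) = suc q , (begin
    P (suc r) + (n + q * n) ≡⟨ cong (_+ (n + q * n)) at0 ⟩
    n + q * n               ≡⟨ cong (_+ q * n) (sym wrap) ⟩
    suc (P r + q * n)       ≡⟨ cong suc e ⟩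
    suc (P 0 + r)           ≡⟨ sym (+-suc (P 0) r) ⟩
    P 0 + suc r             ∎)

  backward-winds : ∀ r → Backward r → ∃[ q ] P 0 + q * n ≡ P r + r
  backward-winds zero    _  = 0 , refl
  backward-winds (suc r) bw with backward-winds r (λ j h → bw j (m<n⇒m<1+n h)) | bw r ≤-refl
  ... | q , e | inj₁ next = q , (begin
    P 0 + q * n         ≡⟨ e ⟩
    P r + r             ≡⟨ cong (_+ r) (sym next) ⟩
    suc (P (suc r) + r) ≡⟨ sym (+-suc (P (suc r)) r) ⟩
    P (suc r) + suc r   ∎)
  ... | q , e | inj₂ (wrap , at0) = suc q , (begin
    P 0 + (n + q * n)   ≡⟨ x∙yz≈y∙xz +-commutativeSemigroup (P 0) n (q * n) ⟩
    n + (P 0 + q * n)   ≡⟨ cong (n +_) (trans e (cong (_+ r) at0)) ⟩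
    n + r               ≡⟨ cong (_+ r) (sym wrap) ⟩
    suc (P (suc r) + r) ≡⟨ sym (+-suc (P (suc r)) r) ⟩
    P (suc r) + suc r   ∎)

  winds : ∀ r → (∀ j → j ≤ r → P j < n) → (∀ j → j < r → CycAdj n (P j) (P (suc j)))
        → (∀ j → suc j < r → P (suc (suc j)) ≢ P j) → WindsTo n (P 0) r (P r)
  winds r valid step fresh with monotone r valid step fresh
  ... | inj₁ fw = let q , e = forward-winds r fw in q , inj₁ e
  ... | inj₂ bw = let q , e = backward-winds r bw in q , inj₂ e

module _ {P : ℕ → Set} (P? : Decidable P) where

  crossing : ∀ m u → ¬ P u → P (m + u) → ∃[ s ] ¬ P s × P (suc s)
  crossing zero    u ¬pu pu = ⊥-elim (¬pu pu)
  crossing (suc m) u ¬pu pm with P? (suc u)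
  ... | yes p  = u , ¬pu , p
  ... | no  ¬p = crossing m (suc u) ¬p (subst P (sym (+-suc m u)) pm)

  maximal-run : ∀ m u → P u → ¬ P (m + u)
              → ∃[ r ] r < m × (∀ j → j ≤ r → P (j + u)) × ¬ P (suc (r + u))
  maximal-run zero    u pu ¬pm = ⊥-elim (¬pm pu)
  maximal-run (suc m) u pu ¬pm with P? (suc u)
  ... | no  ¬p = 0 , s≤s z≤n , (λ { zero _ → pu }) , ¬p
  ... | yes p with maximal-run m (suc u) p (¬pm ∘ subst P (+-suc m u))
  ...   | r , r<m , run , ¬pr = suc r , s≤s r<m , run′ , ¬pr ∘ subst P (cong suc (sym (+-suc r u)))
    where
      run′ : ∀ j → j ≤ suc r → P (j + u)
      run′ zero    _         = pu
      run′ (suc j) (s≤s j≤r) = subst P (+-suc j u) (run j j≤r)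

nth-replicate : ∀ {A : Set} (x : A) n j → nth x (replicate n x) j ≡ x
nth-replicate x zero    j       = refl
nth-replicate x (suc n) zero    = refl
nth-replicate x (suc n) (suc j) = nth-replicate x n j

∈-replicate⁻ : ∀ {A : Set} {x y : A} n → y ∈ replicate n x → y ≡ x
∈-replicate⁻ {x = x} n = lookup (replicate⁺ {P = _≡ x} n refl)

nth-∈ : ∀ {A : Set} (x : A) xs j → nth x xs j ≡ x ⊎ nth x xs j ∈ xs
nth-∈ x []       j       = inj₁ refl
nth-∈ x (y ∷ xs) zero    = inj₂ (here refl)
nth-∈ x (y ∷ xs) (suc j) with nth-∈ x xs j
... | inj₁ e = inj₁ e
... | inj₂ h = inj₂ (there h)

nth-++ : ∀ {A : Set} (x : A) xs ys j →
         nth x (xs ++ ys) j ≡ nth x xs j ⊎ ∃[ j′ ] j ≡ length xs + j′ × nth x (xs ++ ys) j ≡ nth x ys j′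
nth-++ x []       ys j       = inj₂ (j , refl , refl)
nth-++ x (_ ∷ xs) ys zero    = inj₁ refl
nth-++ x (_ ∷ xs) ys (suc j) with nth-++ x xs ys j
... | inj₁ e            = inj₁ e
... | inj₂ (j′ , e , e′) = inj₂ (j′ , cong suc e , e′)

removeAt-⊆ : ∀ {A : Set} (xs : List A) j → removeAt xs j ⊆ xs
removeAt-⊆ []       _       ()
removeAt-⊆ (x ∷ xs) zero    h         = there h
removeAt-⊆ (x ∷ xs) (suc j) (here e)  = here e
removeAt-⊆ (x ∷ xs) (suc j) (there h) = there (removeAt-⊆ xs j h)

Aligned : {A : Set} → ℕ → List (List A) → Set
Aligned d xs = d ∣ length xs × (∀ j {w} → w ∈ nth [] xs j → d ∣ j)

aligned-[] : ∀ {A : Set} {d} → Aligned {A} d []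
aligned-[] {d = d} = d ∣0 , λ _ ()

aligned-++ : ∀ {A : Set} {d} (xs ys : List (List A)) → Aligned d xs → Aligned d ys → Aligned d (xs ++ ys)
aligned-++ {d = d} xs ys (d∣xs , xs-aligned) (d∣ys , ys-aligned) =
  subst (d ∣_) (sym (length-++ xs)) (∣m∣n⇒∣m+n d∣xs d∣ys) , entries
  where
    entries : ∀ j {w} → w ∈ nth [] (xs ++ ys) j → d ∣ j
    entries j h with nth-++ [] xs ys j
    ... | inj₁ e                = xs-aligned j (subst (_ ∈_) e h)
    ... | inj₂ (j′ , refl , e) = ∣m∣n⇒∣m+n d∣xs (ys-aligned j′ (subst (_ ∈_) e h))

aligned-block : ∀ {A : Set} k (X : List A) → Aligned (suc k) (X ∷ replicate k [])
aligned-block k X = subst (suc k ∣_) (sym (cong suc (length-replicate k))) ∣-refl , entries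
  where
    entries : ∀ j {w} → w ∈ nth [] (X ∷ replicate k []) j → suc k ∣ j
    entries zero    _ = _ ∣0
    entries (suc j) h with () ← subst (_ ∈_) (nth-replicate [] k j) h

slow⇒2≤f : ∀ {f} → Slow f → ∀ i → 2 ≤ f (suc (suc i))
slow⇒2≤f slow zero    = ≤-reflexive (sym (Slow.f2 slow))
slow⇒2≤f slow (suc i) = ≤-trans (slow⇒2≤f slow i) (proj₁ (Slow.step slow (suc (suc i)) (s≤s z≤n)))

module LayeredWheel (ℓ : ℕ) (f : ℕ → ℕ) (σ : Ordering) where

  open Wheel ℓ f σ hiding (CycNext)

  blocks-⊆ : ∀ v ws j {U′} → U′ ∈ blocks v ws j → U′ ⊆ v ∷ ws
  blocks-⊆ v ws (suc j) h with ∈-++⁻ (blocks v ws j) h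
  ... | inj₁ h′                = blocks-⊆ v ws j h′
  ... | inj₂ (here refl)       = λ { (here e) → here e ; (there w∈) → there (removeAt-⊆ ws j w∈) }
  ... | inj₂ (there U′∈blank) with refl ← ∈-replicate⁻ (ℓ ∸ 3) U′∈blank = λ ()

  path-⊆ : ValidOrdering σ → ∀ i p U {U′} → U′ ∈ path i p U → U′ ⊆ (i , p) ∷ U
  path-⊆ perm i p U = by-case (length U <ᵇ (f (suc i) ∸ 1))
    where
      by-case : ∀ b {U′} → U′ ∈ (if b then ((i , p) ∷ U) ∷ blank else blocks (i , p) (σ i p U) (length U))
              → U′ ⊆ (i , p) ∷ U
      by-case true  (here refl) = λ w∈ → w∈
      by-case true  (there U′∈blank) with refl ← ∈-replicate⁻ (ℓ ∸ 3) U′∈blank = λ ()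
      by-case false h w∈ with blocks-⊆ (i , p) (σ i p U) (length U) h w∈
      ... | here e  = here e
      ... | there h′ = there (∈-resp-↭ (perm i p U) h′)

  expand-⊆ : ValidOrdering σ → ∀ i p Us {U′} → U′ ∈ expand i p Us → ∃[ q ] U′ ⊆ (i , p + q) ∷ nth [] Us q
  expand-⊆ perm i p (U ∷ Us) {U′} h with ∈-++⁻ (path i p U) h
  ... | inj₁ h′ = 0 , subst (λ x → U′ ⊆ (i , x) ∷ U) (sym (+-identityʳ p)) (path-⊆ perm i p U h′)
  ... | inj₂ h′ with expand-⊆ perm i (suc p) Us h′
  ...   | q , sub = suc q , subst (λ x → U′ ⊆ (i , x) ∷ nth [] Us q) (sym (+-suc p q)) sub

  up-⊆-parent : ValidOrdering σ → ∀ i p → ∃[ q ] up (suc (suc i) , p) ⊆ (suc i , q) ∷ up (suc i , q)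
  up-⊆-parent perm i p with nth-∈ [] (layer (suc (suc i))) p
  ... | inj₁ e = 0 , λ w∈ → ⊥-elim (∉[] (subst (_ ∈_) e w∈))
  ... | inj₂ h = expand-⊆ perm (suc i) 0 (layer (suc i)) h

  up-first-layer : ∀ p → up (1 , p) ≡ []
  up-first-layer p = nth-replicate [] ℓ p

  up-lower : ValidOrdering σ → ∀ {i p w} → w ∈ up (i , p) → proj₁ w < i
  up-lower perm {suc zero} {p} w∈ with () ← subst (_ ∈_) (up-first-layer p) w∈
  up-lower perm {suc (suc i)} {p} {w} w∈ =
    let q , sub = up-⊆-parent perm i p in via-parent (up-lower perm {suc i} {q}) (sub w∈)
    where
      via-parent : ∀ {q} → (w ∈ up (suc i , q) → proj₁ w < suc i)
                 → w ∈ (suc i , q) ∷ up (suc i , q) → proj₁ w < suc (suc i)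
      via-parent _     (here refl) = ≤-refl
      via-parent lower (there w∈′) = m<n⇒m<1+n (lower w∈′)

  up-clique : ValidOrdering σ → ∀ {i p x y} → x ∈ up (i , p) → y ∈ up (i , p) → x ≢ y → Adj x y
  up-clique perm {suc zero} {p} x∈ _ _ with () ← subst (_ ∈_) (up-first-layer p) x∈
  up-clique perm {suc (suc i)} {p} {x} {y} x∈ y∈ x≢y =
    let q , sub = up-⊆-parent perm i p in via-parent (up-clique perm {suc i} {q}) (sub x∈) (sub y∈)
    where
      via-parent : ∀ {q} → (x ∈ up (suc i , q) → y ∈ up (suc i , q) → x ≢ y → Adj x y)
                 → x ∈ (suc i , q) ∷ up (suc i , q) → y ∈ (suc i , q) ∷ up (suc i , q) → Adj x y
      via-parent     _      (here refl) (here refl) = ⊥-elim (x≢y refl)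
      via-parent {q} _      (here refl) (there y∈′) = inj₂ (inj₁ (up-lower perm {suc i} {q} y∈′ , y∈′))
      via-parent {q} _      (there x∈′) (here refl) = inj₂ (inj₂ (up-lower perm {suc i} {q} x∈′ , x∈′))
      via-parent     clique (there x∈′) (there y∈′) = clique x∈′ y∈′ x≢y

  -- From L₂ on, layers consist of blocks of length ℓ - 2 = suc (ℓ ∸ 3) headed by their only
  -- vertices with upward neighbours.
  aligned-layer : ∀ {i} → 2 ≤ i → Aligned (suc (ℓ ∸ 3)) (layer i)
  aligned-layer {suc zero} (s≤s ())
  aligned-layer {suc (suc i)} _ = aligned-expand 0 (layer (suc i))
    where
      aligned-blocks : ∀ v ws j → Aligned (suc (ℓ ∸ 3)) (blocks v ws j)
      aligned-blocks v ws zero    = aligned-[]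
      aligned-blocks v ws (suc j) =
        aligned-++ (blocks v ws j) _ (aligned-blocks v ws j) (aligned-block (ℓ ∸ 3) (v ∷ removeAt ws j))

      aligned-path : ∀ p U b → Aligned (suc (ℓ ∸ 3))
        (if b then ((suc i , p) ∷ U) ∷ blank else blocks (suc i , p) (σ (suc i) p U) (length U))
      aligned-path p U true  = aligned-block (ℓ ∸ 3) _
      aligned-path p U false = aligned-blocks (suc i , p) (σ (suc i) p U) (length U)

      aligned-expand : ∀ p Us → Aligned (suc (ℓ ∸ 3)) (expand (suc i) p Us)
      aligned-expand p []       = aligned-[]
      aligned-expand p (U ∷ Us) =
        aligned-++ (path (suc i) p U) _ (aligned-path p U (length U <ᵇ f (suc (suc i)) ∸ 1))
                   (aligned-expand (suc p) Us)

  path-nonempty : ∀ {i} → 2 ≤ f (suc i) → ∀ p U → 1 ≤ length (path i p U)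
  path-nonempty {i} 2≤f p U = by-case (length U) (f (suc i) ∸ 1) (∸-monoˡ-≤ 1 2≤f)
    where
      by-case : ∀ a b → 1 ≤ b
              → 1 ≤ length (if a <ᵇ b then ((i , p) ∷ U) ∷ blank else blocks (i , p) (σ i p U) a)
      by-case zero    (suc b) _ = s≤s z≤n
      by-case (suc a) b       _ with suc a <ᵇ b
      ... | true  = s≤s z≤n
      ... | false = subst (1 ≤_) (sym (length-++ (blocks (i , p) (σ i p U) a)))
                          (≤-trans (s≤s z≤n) (m≤n+m _ _))

  expand-length-≥ : ∀ {i} → 2 ≤ f (suc i) → ∀ p Us → length Us ≤ length (expand i p Us)
  expand-length-≥ 2≤f p []       = z≤n
  expand-length-≥ {i} 2≤f p (U ∷ Us) = subst (suc (length Us) ≤_) (sym (length-++ (path i p U)))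
    (+-mono-≤ (path-nonempty 2≤f p U) (expand-length-≥ 2≤f (suc p) Us))

  layer-size-≥ : Slow f → ∀ {i} → 1 ≤ i → ℓ ≤ size i
  layer-size-≥ slow {suc zero}    _ = ≤-reflexive (sym (length-replicate ℓ))
  layer-size-≥ slow {suc (suc i)} _ =
    ≤-trans (layer-size-≥ slow {suc i} (s≤s z≤n)) (expand-length-≥ (slow⇒2≤f slow i) 0 (layer (suc i)))

  adj-same-layer : ∀ {i x y} → proj₁ x ≡ i → proj₁ y ≡ i → Adj x y → CycAdj (size i) (proj₂ x) (proj₂ y)
  adj-same-layer refl _  (inj₁ (_ , adjacent))   = adjacent
  adj-same-layer refl ey (inj₂ (inj₁ (y<x , _))) = ⊥-elim (<-irrefl ey y<x)
  adj-same-layer refl ey (inj₂ (inj₂ (x<y , _))) = ⊥-elim (<-irrefl (sym ey) x<y)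

  adj-below⇒∈up : ∀ {x y} → proj₁ y < proj₁ x → Adj x y → y ∈ up x
  adj-below⇒∈up y<x (inj₁ (x≡y , _))        = ⊥-elim (<-irrefl (sym x≡y) y<x)
  adj-below⇒∈up y<x (inj₂ (inj₁ (_ , y∈)))  = y∈
  adj-below⇒∈up y<x (inj₂ (inj₂ (x<y , _))) = ⊥-elim (<-asym y<x x<y)

  below-adj⇒∈up : ∀ {x y} → proj₁ y < proj₁ x → Adj y x → y ∈ up x
  below-adj⇒∈up y<x (inj₁ (y≡x , _))        = ⊥-elim (<-irrefl y≡x y<x)
  below-adj⇒∈up y<x (inj₂ (inj₁ (x<y , _))) = ⊥-elim (<-asym y<x x<y)
  below-adj⇒∈up y<x (inj₂ (inj₂ (_ , y∈)))  = y∈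

  up-position-∣ : ∀ {i p w} → 2 ≤ i → w ∈ up (i , p) → suc (ℓ ∸ 3) ∣ p
  up-position-∣ 2≤i w∈ = proj₂ (aligned-layer 2≤i) _ w∈

  module Hole (perm : ValidOrdering σ) (slow : Slow f) {k : ℕ} (c : Fin (suc k) → Vtx)
              (4≤k : 4 ≤ suc k) (valid : ∀ a → Valid (c a)) (injective : Injective _≡_ _≡_ c)
              (adjacency : ∀ a b → (Adj (c a) (c b) → CycAdjFin (suc k) a b)
                                 × (CycAdjFin (suc k) a b → Adj (c a) (c b))) where

    idx : ℕ → Fin (suc k)
    idx t = fromℕ< (m%n<n t (suc k))

    toℕ-idx : ∀ t → toℕ (idx t) ≡ t % suc k
    toℕ-idx t = toℕ-fromℕ< (m%n<n t (suc k))

    g : ℕ → Vtx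
    g t = c (idx t)

    idx-next : ∀ t → CycNext (suc k) (toℕ (idx t)) (toℕ (idx (suc t)))
    idx-next t = subst₂ (CycNext (suc k)) (sym (toℕ-idx t)) (sym (toℕ-idx (suc t))) (cycNext-% (suc k) t)

    g-valid : ∀ t → Valid (g t)
    g-valid t = valid (idx t)

    g-adj : ∀ t → Adj (g t) (g (suc t))
    g-adj t = proj₂ (adjacency (idx t) (idx (suc t))) (inj₁ (idx-next t))

    g-≢ : ∀ t → g (suc (suc t)) ≢ g t
    g-≢ t e = cycNext²-≢ (idx-next t) (idx-next (suc t)) (≤-trans (n≤1+n 3) 4≤k)
                (cong toℕ (injective e))

    g-¬adj : ∀ t → ¬ Adj (g t) (g (suc (suc t)))
    g-¬adj t a = cycNext²-¬cycAdj (idx-next t) (idx-next (suc t)) 4≤k (proj₁ (adjacency _ _) a)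

    g-periodic : ∀ t → g (suc k + t) ≡ g t
    g-periodic t = cong c (toℕ-injective (begin
      toℕ (idx (suc k + t)) ≡⟨ toℕ-idx (suc k + t) ⟩
      (suc k + t) % suc k   ≡⟨ %-remove-+ˡ t ∣-refl ⟩
      t % suc k             ≡⟨ sym (toℕ-idx t) ⟩
      toℕ (idx t)           ∎))

    g-toℕ : ∀ a → g (toℕ a) ≡ c a
    g-toℕ a = cong c (toℕ-injective (trans (toℕ-idx (toℕ a)) (m<n⇒m%n≡m (toℕ<n a))))

    top : Fin (suc k)
    top = argmax (proj₁ ∘ c) zero (allFin (suc k))

    top-layer : ℕ
    top-layer = proj₁ (c top)

    OnTop : ℕ → Set
    OnTop t = proj₁ (g t) ≡ top-layer

    onTop? : Decidable OnTop
    onTop? t = proj₁ (g t) ≟ top-layer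

    below-top : ∀ {t} → ¬ OnTop t → proj₁ (g t) < top-layer
    below-top {t} off =
      ≤∧≢⇒< (lookup (f[xs]≤f[argmax] {f = proj₁ ∘ c} zero (allFin (suc k))) (∈-allFin (idx t))) off

    enters : ∀ {s} → ¬ OnTop s → OnTop (suc s) → g s ∈ up (g (suc s))
    enters {s} off on = below-adj⇒∈up (subst (proj₁ (g s) <_) (sym on) (below-top {s} off)) (g-adj s)

    leaves : ∀ {t} → OnTop t → ¬ OnTop (suc t) → g (suc t) ∈ up (g t)
    leaves {t} on off =
      adj-below⇒∈up (subst (proj₁ (g (suc t)) <_) (sym on) (below-top {suc t} off)) (g-adj t)

    top-walk : ∀ u r → (∀ j → j ≤ r → OnTop (j + u))
             → WindsTo (size top-layer) (proj₂ (g u)) r (proj₂ (g (r + u)))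
    top-walk u r on = CycleWalk.winds (size top-layer) (λ j → proj₂ (g (j + u))) r in-layer step fresh
      where
        in-layer : ∀ j → j ≤ r → proj₂ (g (j + u)) < size top-layer
        in-layer j j≤r = subst (λ i → proj₂ (g (j + u)) < size i) (on j j≤r) (proj₂ (g-valid (j + u)))
        step : ∀ j → j < r → CycAdj (size top-layer) (proj₂ (g (j + u))) (proj₂ (g (suc j + u)))
        step j j<r = adj-same-layer (on j (<⇒≤ j<r)) (on (suc j) j<r) (g-adj (j + u))
        fresh : ∀ j → suc j < r → proj₂ (g (suc (suc j) + u)) ≢ proj₂ (g (j + u))
        fresh j 1+j<r e = g-≢ (j + u)
          (×-≡,≡→≡ (trans (on (suc (suc j)) 1+j<r) (sym (on j (≤-trans (n≤1+n j) (<⇒≤ 1+j<r)))) , e))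

    all-on-top⇒ℓ≤length : (∀ t → OnTop t) → ℓ ≤ suc k
    all-on-top⇒ℓ≤length on = ≤-trans (layer-size-≥ slow 1≤top) (∣⇒≤ size∣k)
      where
        1≤top : 1 ≤ top-layer
        1≤top = subst (1 ≤_) (on 0) (proj₁ (g-valid 0))
        size∣k : size top-layer ∣ suc k
        size∣k = windsTo-closed (subst (WindsTo (size top-layer) (proj₂ (g 0)) (suc k))
                   (cong proj₂ (g-periodic 0)) (top-walk 0 (suc k) (λ j _ → on (j + 0))))

    -- The ends of a maximal run in the top layer have upward neighbours on the hole: for r = 0 the
    -- single vertex has two of them, which are adjacent, and otherwise both ends sit at positions
    -- divisible by ℓ - 2.
    run-length : ∀ s r → ¬ OnTop s → (∀ j → j ≤ r → OnTop (j + suc s)) → ¬ OnTop (suc (r + suc s))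
               → ℓ ≤ 2 + r
    run-length s zero off on off′ = ⊥-elim (g-¬adj s
      (up-clique perm {proj₁ (g (suc s))} (enters off (on 0 z≤n)) (leaves (on 0 z≤n) off′) (g-≢ s ∘ sym)))
    run-length s (suc r) off on off′ = ≤-trans (m≤n+m∸n ℓ 3) (s≤s (s≤s (∣⇒≤ d∣r)))
      where
        2≤top : 2 ≤ top-layer
        2≤top = ≤-trans (s≤s (proj₁ (g-valid s))) (below-top {s} off)
        2≤layer : ∀ j → j ≤ suc r → 2 ≤ proj₁ (g (j + suc s))
        2≤layer j j≤r = subst (2 ≤_) (sym (on j j≤r)) 2≤top
        d∣r : suc (ℓ ∸ 3) ∣ suc r
        d∣r = windsTo-∣ (proj₁ (aligned-layer 2≤top))
          (up-position-∣ (2≤layer 0 z≤n) (enters off (on 0 z≤n)))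
          (up-position-∣ (2≤layer (suc r) ≤-refl) (leaves (on (suc r) ≤-refl) off′))
          (top-walk (suc s) (suc r) on)

    on-top-periodic : ∀ t → OnTop (k + suc t) → OnTop t
    on-top-periodic t = trans (cong proj₁ (sym (trans (cong g (+-suc k t)) (g-periodic t))))

    entry⇒ℓ≤length : ∃[ s ] ¬ OnTop s × OnTop (suc s) → ℓ ≤ suc k
    entry⇒ℓ≤length (s , s-off , s+1-on)
      with maximal-run onTop? k (suc s) s+1-on (s-off ∘ on-top-periodic s)
    ... | r , r<k , run , run-end = ≤-trans (run-length s r s-off run run-end) (s≤s r<k)

    below-top⇒ℓ≤length : ∀ b → ¬ OnTop (toℕ b) → ℓ ≤ suc k
    below-top⇒ℓ≤length b off =
      entry⇒ℓ≤length (crossing onTop? (suc k + toℕ top ∸ toℕ b) (toℕ b) off top-on)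
      where
        b≤ : toℕ b ≤ suc k + toℕ top
        b≤ = ≤-trans (<⇒≤ (toℕ<n b)) (m≤m+n (suc k) (toℕ top))
        top-on : OnTop ((suc k + toℕ top ∸ toℕ b) + toℕ b)
        top-on = cong proj₁ (begin
          g ((suc k + toℕ top ∸ toℕ b) + toℕ b) ≡⟨ cong g (m∸n+n≡m b≤) ⟩
          g (suc k + toℕ top)                   ≡⟨ g-periodic (toℕ top) ⟩
          g (toℕ top)                           ≡⟨ g-toℕ top ⟩
          c top                                 ∎)

    ℓ≤length : ℓ ≤ suc k
    ℓ≤length with all? (λ a → proj₁ (c a) ≟ top-layer)
    ... | yes all-top = all-on-top⇒ℓ≤length (λ t → all-top (idx t))
    ... | no ¬all-top with ¬∀⟶∃¬ (suc k) _ (λ a → proj₁ (c a) ≟ top-layer) ¬all-top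
    ...   | b , b-off = below-top⇒ℓ≤length b (b-off ∘ trans (cong proj₁ (sym (g-toℕ b))))

mainTheorem5 : (ℓ : ℕ) → 4 ≤ ℓ → (f : ℕ → ℕ) → Slow f →
    (σ : Ordering) → ValidOrdering σ →
    (k : ℕ) (c : Fin k → Vtx) → Wheel.IsHole ℓ f σ k c → ℓ ≤ k
mainTheorem5 ℓ _ f slow σ perm zero    c (() , _)
mainTheorem5 ℓ _ f slow σ perm (suc k) c (4≤k , valid , injective , adjacency) =
  LayeredWheel.Hole.ℓ≤length ℓ f σ perm slow c 4≤k valid injective adjacency
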